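{- Let $(f,\alpha)$ and $(g,\beta)$ be coherent labelled coloured configurations. Then $$W_{f,\alpha}^{\varepsilon} *_Y W_{g,\beta}^{\varepsilon} = W_{f\sqcup\!\sqcup g, \, \alpha\cup\beta}^{\varepsilon}$$ for each $\varepsilon\in \mathbb{Z}$.
   Context: Colours are elements of the poset $\Gamma=\{0>1>2>\dotsb\}$. On coloured positive integers $\sigma^\gamma$ ($\sigma\in\{1,2,\dots\}$, $\gamma\in\Gamma$) use the colour order $\dotsb<1^1<2^1<\dotsb<1^0<2^0<\dotsb$, i.e. $\sigma_1^{\gamma_1}<\sigma_2^{\gamma_2}$ iff $\gamma_1=\gamma_2$ and $\sigma_1<\sigma_2$, or $\gamma_1>\gamma_2$ as integers. A coloured permutation is a string $\bm a=\sigma_1^{\gamma_1}\dotsb\sigma_n^{\gamma_n}$ with distinct positive integers $\sigma_i$ and arbitrary colours $\gamma_i$; $|\bm a|=n$, its set of symbols is $\{\sigma_1,\dots,\sigma_n\}$, its palette is $\{\gamma_1,\dots,\gamma_n\}$, and $\mathrm{Pal}^*(\bm a)$ is the palette minus $\{0\}$. Its descent set is $\mathrm{Des}(\bm a)=\{i\in[n-1]:\sigma_i^{\gamma_i}>\sigma_{i+1}^{\gamma_{i+1}}\}$ if $\gamma_1=0$, and this set together with $0$ otherwise; $\operatorname{des}(\bm a)=|\mathrm{Des}(\bm a)|$, $\operatorname{comaj}(\bm a)=\sum_{i\in\mathrm{Des}(\bm a)}(n-i)$. A coloured configuration is an element $f=\sum_{\bm a} f_{\bm a}\bm a$ of the free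 commutative monoid on coloured permutations (a finite multiset); $\mathrm{supp}(f)$, its symbols and $\mathrm{Pal}^*(f)$ are unions over the support. $f,g$ are disjoint if their symbol sets are disjoint. For disjoint $\bm a,\bm b$, $\bm a\sqcup\!\sqcup\bm b$ denotes the shuffle product, the sum of all shuffles of $\bm a$ and $\bm b$, extended bi-additively to disjoint configurations. Let $\mathbb U=\{\pm X^k:k\in\mathbb{Z}\}\subset\mathbb{Q}(X)^\times$. For $\alpha:\Gamma\to\mathbb U$, $\mathrm{supp}(\alpha)=\{c:\alpha(c)\neq1\}$ and $\alpha(\bm a)=\prod_i\alpha(\gamma_i)$. A labelled coloured configuration is a pair $(f,\alpha)$ with $\mathrm{supp}(\alpha)\subseteq \mathrm{Pal}^*(f)$. $(f,\alpha)$ and $(g,\beta)$ are coherent if $f,g$ are disjoint and $\alpha(c)=\beta(c)$ for all $c\in\mathrm{Pal}^*(f)\cap\mathrm{Pal}^*(g)$; then $\alpha\cup\beta$ equals $\alpha$ on $\mathrm{Pal}^*(f)$, $\beta$ on $\mathrm{Pal}^*(g)$, and $1$ elsewhere. For $\varepsilon\in\mathbb{Z}$, $$W_{f,\alpha}^{\varepsilon}(X,Y)=\sum_{\bm a\in\mathrm{supp}(f)} f_{\bm a}\frac{\alpha(\bm a)X^{\varepsilon\operatorname{comaj}(\bm a)}Y^{\operatorname{des}(\bm a)}}{(1-Y)(1-X^{\varepsilon}Y)\dotsb(1-X^{\varepsilon|\bm a|}Y)}\in\mathbb{Q}(X)[[Y]].$$ $*_Y$ is the Hadamard product in $Y$: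 $\sum a_kY^k *_Y\sum b_kY^k=\sum a_kb_kY^k$. -}

module Defs where

open import Data.Nat as ℕ using (ℕ; zero; suc; _<ᵇ_; _≡ᵇ_)
open import Data.Integer as ℤ using (ℤ; +_; -_)
open import Data.Bool using (Bool; true; false; if_then_else_; _∧_; _∨_; not; _xor_)
open import Data.List using (List; []; _∷_; _++_; map; concatMap; foldr; length)
open import Data.Bool.ListAction using (any)
open import Data.Product using (_×_; _,_; proj₁; proj₂)
open import Data.Empty using (⊥)
open import Relation.Binary.PropositionalEquality using (_≡_; _≢_)
open import Relation.Nullary using (¬_; does)

-- Laurent polynomials in X with integer coefficients, as finite formal
-- sums of monomials (exponent , coefficient).  Equality is equality of
-- all coefficients.  (ℤ[X,X⁻¹] ⊂ ℚ(X); all coefficients occurring here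
-- lie in this subring.)

LP : Set
LP = List (ℤ × ℤ)

0L : LP
0L = []

mon : ℤ → ℤ → LP
mon c e = (e , c) ∷ []

_+L_ : LP → LP → LP
p +L q = p ++ q

_*L_ : LP → LP → LP
p *L q = concatMap (λ t → map (λ s → (proj₁ t ℤ.+ proj₁ s , proj₂ t ℤ.* proj₂ s)) q) p

coeffL : LP → ℤ → ℤ
coeffL [] e = + 0
coeffL ((e' , c) ∷ p) e = (if does (e' ℤ.≟ e) then c else + 0) ℤ.+ coeffL p e

_≈L_ : LP → LP → Set
p ≈L q = ∀ e → coeffL p e ≡ coeffL q e

-- Formal power series in Y with Laurent-polynomial coefficients:
-- a series is its coefficient sequence.

Series : Set
Series = ℕ → LP

_≈S_ : Series → Series → Set
A ≈S B = ∀ m → A m ≈L B m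

_*Y_ : Series → Series → Series
(A *Y B) m = A m *L B m

0S : Series
0S _ = 0L

_+S_ : Series → Series → Series
(A +S B) m = A m +L B m

scaleS : LP → Series → Series
scaleS c A m = c *L A m

shiftY : ℕ → Series → Series
shiftY zero A m = A m
shiftY (suc d) A zero = 0L
shiftY (suc d) A (suc m) = shiftY d A m

-- Cauchy product: (A·B)_m = Σ_{i=0}^m A_i B_{m-i}
conv : Series → Series → Series
conv A B zero = A 0 *L B 0
conv A B (suc m) = (A 0 *L B (suc m)) +L conv (λ i → A (suc i)) B m

-- 1/(1 - X^e Y) = Σ_k X^{e k} Y^k
geom : ℤ → Series
geom e k = mon (+ 1) (e ℤ.* + k)

-- 1/((1-Y)(1-X^ε Y)⋯(1-X^{ε n} Y))
invDenom : ℤ → ℕ → Series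
invDenom ε zero = geom (+ 0)
invDenom ε (suc n) = conv (invDenom ε n) (geom (ε ℤ.* + suc n))

-- Colours are natural numbers (Γ = {0 > 1 > 2 > ⋯}).
-- A coloured letter σ^γ is a pair (σ , γ); symbols are positive integers
-- (enforced by the validity predicate below).

Letter : Set
Letter = ℕ × ℕ

_<C_ : Letter → Letter → Bool
(σ₁ , γ₁) <C (σ₂ , γ₂) = ((γ₁ ≡ᵇ γ₂) ∧ (σ₁ <ᵇ σ₂)) ∨ (γ₂ <ᵇ γ₁)

CPerm : Set
CPerm = List Letter

symbols : CPerm → List ℕ
symbols = map proj₁

data Distinct : List ℕ → Set where
  []  : Distinct []
  _∷_ : ∀ {x xs} → any (λ y → x ≡ᵇ y) xs ≡ false → Distinct xs → Distinct (x ∷ xs)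

ValidCPerm : CPerm → Set
ValidCPerm a = Distinct (symbols a) × (any (λ l → proj₁ l ≡ᵇ 0) a ≡ false)

-- Descents among positions 1..n-1 of a (nonempty) word, together with
-- their contributions n - i to comaj.  descsFrom i w: w is the suffix
-- starting at position i; returns list of descent positions.
descsFrom : ℕ → CPerm → List ℕ
descsFrom i [] = []
descsFrom i (x ∷ []) = []
descsFrom i (x ∷ y ∷ w) =
  (if y <C x then i ∷ [] else []) ++ descsFrom (suc i) (y ∷ w)

Des : CPerm → List ℕ
Des [] = []
Des ((σ , γ) ∷ w) =
  (if γ ≡ᵇ 0 then [] else 0 ∷ []) ++ descsFrom 1 ((σ , γ) ∷ w)

des : CPerm → ℕ
des a = length (Des a)

comaj : CPerm → ℕ
comaj a = foldr (λ i s → (length a ℕ.∸ i) ℕ.+ s) 0 (Des a)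

-- Coloured configurations: finite multisets of coloured permutations,
-- represented as lists (multiplicity = number of occurrences).

Config : Set
Config = List CPerm

ValidConfig : Config → Set
ValidConfig f = ∀ {a} → a ∈ f → ValidCPerm a
  where open import Data.List.Membership.Propositional using (_∈_)

symbolsC : Config → List ℕ
symbolsC f = concatMap symbols f

inPal* : ℕ → Config → Bool
inPal* c f = not (c ≡ᵇ 0) ∧ any (λ a → any (λ l → proj₂ l ≡ᵇ c) a) f

Disjoint : Config → Config → Set
Disjoint f g = ∀ s → any (λ t → s ≡ᵇ t) (symbolsC f) ≡ true
                   → any (λ t → s ≡ᵇ t) (symbolsC g) ≡ true → ⊥

shuffle : CPerm → CPerm → List CPerm
shuffle [] b = b ∷ []
shuffle (x ∷ a) [] = (x ∷ a) ∷ []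
shuffle (x ∷ a) (y ∷ b) =
  map (x ∷_) (shuffle a (y ∷ b)) ++ map (y ∷_) (shuffle (x ∷ a) b)

_⧢_ : Config → Config → Config
f ⧢ g = concatMap (λ a → concatMap (λ b → shuffle a b) g) f

record U : Set where
  constructor ±X^
  field
    negative : Bool
    expo     : ℤ
open U public

oneU : U
oneU = ±X^ false (+ 0)

_*U_ : U → U → U
u *U v = ±X^ (negative u xor negative v) (expo u ℤ.+ expo v)

toLP : U → LP
toLP u = mon (if negative u then - (+ 1) else + 1) (expo u)

Labelling : Set
Labelling = ℕ → U

evalU : Labelling → CPerm → U
evalU α a = foldr (λ l u → α (proj₂ l) *U u) oneU a

LabelledConfig : Config → Labelling → Set
LabelledConfig f α = ValidConfig f × (∀ c → α c ≢ oneU → inPal* c f ≡ true)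

Coherent : Config → Labelling → Config → Labelling → Set
Coherent f α g β =
  Disjoint f g × (∀ c → inPal* c f ≡ true → inPal* c g ≡ true → α c ≡ β c)

_∪L_ : (Config × Labelling) → (Config × Labelling) → Labelling
((f , α) ∪L (g , β)) c =
  if inPal* c f then α c else (if inPal* c g then β c else oneU)

Wperm : ℤ → Labelling → CPerm → Series
Wperm ε α a =
  shiftY (des a)
    (scaleS (toLP (evalU α a) *L mon (+ 1) (ε ℤ.* + comaj a))
            (invDenom ε (length a)))

W : ℤ → Config → Labelling → Series
W ε [] α = 0S
W ε (a ∷ f) α = Wperm ε α a +S W ε f α

-- For a single coloured permutation a, the coefficient of Yᵐ in its term of W is α(a) times the sum of
-- X^(ε(v₁ + ⋯ + vₙ)) over the sequences 0 ≤ v₁ ≤ ⋯ ≤ vₙ ≤ m that increase strictly at the descents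
-- of a (a descent at 0 forcing v₁ ≥ 1): summing over the value of the first letter is a Cauchy product
-- with 1/(1 - X^(εn) Y), which builds the denominator of W one factor at a time.  Pairs of such
-- sequences for a and for b correspond bijectively to such sequences for the shuffles c of a and b:
-- merge the letters by their values, breaking ties by the colour order, which is total on letters with
-- distinct symbols.  So the Hadamard product of the terms of a and b is the sum of the terms of the
-- shuffles c, all carrying the label α(a) β(b), which by coherence is (α ∪ β)(c).
module Submission where

open import Defs
open import Data.Integer as ℤ using (ℤ; _-_)
open import Data.Product using (_×_; _,_; proj₁; proj₂)

open import Level using (Level; 0ℓ)
open import Algebra.Bundles using (CommutativeSemiring)
open import Algebra.Structures.Biased using (isCommutativeSemiringˡ)
open import Data.Bool using (Bool; true; false; if_then_else_; not; T)
import Data.Bool.Properties as Bool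
open import Data.Bool.ListAction using (any)
open import Data.Empty using (⊥-elim)
import Data.Integer.Properties as ℤP
open import Data.Integer.Tactic.RingSolver using (solve-∀)
open import Data.List using (List; []; _∷_; _++_; map; concatMap; foldr; length; upTo)
import Data.List.Properties as List
open import Data.List.Membership.Propositional using (_∈_; lose)
open import Data.List.Membership.Propositional.Properties using (∈-upTo⁻; ∈-map⁺; ∈-concatMap⁺)
open import Data.List.Relation.Unary.All as All using (All; []; _∷_)
import Data.List.Relation.Unary.All.Properties as AllP
open import Data.List.Relation.Unary.Any using (here; there)
open import Data.List.Relation.Unary.Any.Properties using (any⁺)
open import Data.Nat as ℕ using (ℕ; zero; suc; _∸_; _≤_; _<_; z≤n; s≤s; s≤s⁻¹; _≤ᵇ_; _<ᵇ_; _≡ᵇ_; _<?_)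
import Data.Nat.Properties as ℕP
import Data.Nat.Tactic.RingSolver as ℕ-Solver
open import Data.Sum as Sum using (_⊎_; inj₁; inj₂)
open import Function using (_∘_)
open import Function.Bundles using (_⇔_; mk⇔; Equivalence)
open import Relation.Binary.Definitions using (Decidable; DecidableEquality; tri<; tri≈; tri>)
import Relation.Binary.PropositionalEquality as ≡
open ≡ using (_≡_; _≢_)
open import Relation.Binary.Structures using (IsEquivalence)
open import Relation.Nullary using (¬_; Dec; does; _because_; yes; no)
open import Relation.Nullary.Decidable using (does-⇔; dec-true; dec-false; map′; _×-dec_)
open import Relation.Nullary.Reflects using (fromEquivalence; _×-reflects_; _⊎-reflects_)

-- Finite sums in a commutative semiring

<ᵇ-suc : ∀ m n → (m <ᵇ suc n) ≡ (m ≤ᵇ n)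
<ᵇ-suc zero    n = ≡.refl
<ᵇ-suc (suc m) n = ≡.refl

≤⇒suc≰ᵇ : ∀ {v m} → v ≤ m → (suc m ≤ᵇ v) ≡ false
≤⇒suc≰ᵇ z≤n       = ≡.refl
≤⇒suc≰ᵇ (s≤s v≤m) = ≤⇒suc≰ᵇ v≤m

module FiniteSum {c ℓ} (R : CommutativeSemiring c ℓ) where

  open CommutativeSemiring R
  open import Algebra.Properties.CommutativeSemigroup +-commutativeSemigroup using (interchange)
  open import Relation.Binary.Reasoning.Setoid setoid

  private variable
    a : Level
    A B : Set a
    x y : Carrier
    xs : List A
    f g : A → Carrier

  ∑ : List A → (A → Carrier) → Carrier
  ∑ []       f = 0#
  ∑ (x ∷ xs) f = f x + ∑ xs f

  syntax ∑ xs (λ x → e) = ∑[ x ∈ xs ] e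

  ∑-cong-∈ : (∀ {x} → x ∈ xs → f x ≈ g x) → ∑ xs f ≈ ∑ xs g
  ∑-cong-∈ {xs = []}     eq = refl
  ∑-cong-∈ {xs = x ∷ xs} eq = +-cong (eq (here ≡.refl)) (∑-cong-∈ (eq ∘ there))

  ∑-cong : (xs : List A) → (∀ x → f x ≈ g x) → ∑ xs f ≈ ∑ xs g
  ∑-cong xs eq = ∑-cong-∈ {xs = xs} (λ {x} _ → eq x)

  ∑-0# : (xs : List A) → ∑[ x ∈ xs ] 0# ≈ 0#
  ∑-0# []       = refl
  ∑-0# (x ∷ xs) = trans (+-identityˡ _) (∑-0# xs)

  ∑-++ : (xs ys : List A) (f : A → Carrier) → ∑ (xs ++ ys) f ≈ ∑ xs f + ∑ ys f
  ∑-++ []       ys f = sym (+-identityˡ _)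
  ∑-++ (x ∷ xs) ys f = trans (+-congˡ (∑-++ xs ys f)) (sym (+-assoc _ _ _))

  ∑-map : (h : A → B) (xs : List A) (f : B → Carrier) → ∑ (map h xs) f ≡ ∑ xs (f ∘ h)
  ∑-map h []       f = ≡.refl
  ∑-map h (x ∷ xs) f = ≡.cong (f (h x) +_) (∑-map h xs f)

  ∑-concatMap : (h : A → List B) (xs : List A) (f : B → Carrier) →
                ∑ (concatMap h xs) f ≈ ∑[ x ∈ xs ] ∑ (h x) f
  ∑-concatMap h []       f = refl
  ∑-concatMap h (x ∷ xs) f = trans (∑-++ (h x) _ f) (+-congˡ (∑-concatMap h xs f))

  ∑-distrib-+ : (xs : List A) (f g : A → Carrier) → ∑[ x ∈ xs ] (f x + g x) ≈ ∑ xs f + ∑ xs g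
  ∑-distrib-+ []       f g = sym (+-identityˡ 0#)
  ∑-distrib-+ (x ∷ xs) f g = trans (+-congˡ (∑-distrib-+ xs f g)) (interchange _ _ _ _)

  *-distribˡ-∑ : (p : Carrier) (xs : List A) (f : A → Carrier) → p * ∑ xs f ≈ ∑[ x ∈ xs ] (p * f x)
  *-distribˡ-∑ p []       f = zeroʳ p
  *-distribˡ-∑ p (x ∷ xs) f = trans (distribˡ p _ _) (+-congˡ (*-distribˡ-∑ p xs f))

  *-distribʳ-∑ : (xs : List A) (f : A → Carrier) (p : Carrier) → ∑ xs f * p ≈ ∑[ x ∈ xs ] (f x * p)
  *-distribʳ-∑ xs f p = trans (*-comm _ p) (trans (*-distribˡ-∑ p xs f) (∑-cong xs (λ x → *-comm p (f x))))

  ∑-comm : (xs : List A) (ys : List B) (f : A → B → Carrier) →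
           ∑[ x ∈ xs ] ∑[ y ∈ ys ] f x y ≈ ∑[ y ∈ ys ] ∑[ x ∈ xs ] f x y
  ∑-comm []       ys f = sym (∑-0# ys)
  ∑-comm (x ∷ xs) ys f = trans (+-congˡ (∑-comm xs ys f)) (sym (∑-distrib-+ ys (f x) _))

  ∑-*-∑ : (xs : List A) (ys : List B) (f : A → Carrier) (g : B → Carrier) →
          ∑ xs f * ∑ ys g ≈ ∑[ x ∈ xs ] ∑[ y ∈ ys ] (f x * g y)
  ∑-*-∑ xs ys f g = trans (*-distribʳ-∑ xs f _) (∑-cong xs (λ x → *-distribˡ-∑ (f x) ys g))

  when : Bool → Carrier → Carrier
  when b x = if b then x else 0#

  when-cong : ∀ b → x ≈ y → when b x ≈ when b y
  when-cong true  x≈y = x≈y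
  when-cong false _   = refl

  when-*ˡ : ∀ b x y → when b x * y ≈ when b (x * y)
  when-*ˡ true  x y = refl
  when-*ˡ false x y = zeroˡ y

  when-*ʳ : ∀ b x y → x * when b y ≈ when b (x * y)
  when-*ʳ true  x y = refl
  when-*ʳ false x y = zeroʳ x

  ∑-when : ∀ b (xs : List A) f → ∑[ x ∈ xs ] when b (f x) ≈ when b (∑ xs f)
  ∑-when true  xs f = refl
  ∑-when false xs f = ∑-0# xs

  when-split : ∀ i j r x → (T i → T r → T j) → (T j → T (not r) → T i) →
               when i (when j x) ≈ when i (when r x) + when j (when (not r) x)
  when-split true  true  true  x _ _ = sym (+-identityʳ x)
  when-split true  true  false x _ _ = sym (+-identityˡ x)
  when-split false true  true  x _ _ = sym (+-identityˡ 0#)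
  when-split false false r     x _ _ = sym (+-identityˡ 0#)
  when-split true  false true  x i⇒j _ with () ← i⇒j _ _
  when-split true  false false x _ _ = sym (+-identityˡ 0#)
  when-split false true  false x _ j⇒i with () ← j⇒i _ _

  ∑≤ : ℕ → (ℕ → Carrier) → Carrier
  ∑≤ m f = ∑ (upTo (suc m)) f

  syntax ∑≤ m (λ v → e) = ∑[ v ≤ m ] e

  ∑≤-suc : ∀ m f → ∑≤ (suc m) f ≡ f 0 + ∑[ v ≤ m ] f (suc v)
  ∑≤-suc m f = ≡.cong (f 0 +_)
    (≡.trans (≡.cong (λ vs → ∑ vs f) (≡.sym (List.map-applyUpTo (λ v → v) suc (suc m))))
             (∑-map suc (upTo (suc m)) f))

  ∑≤-cong-≤ : ∀ m {f g : ℕ → Carrier} → (∀ v → v ≤ m → f v ≈ g v) → ∑≤ m f ≈ ∑≤ m g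
  ∑≤-cong-≤ m eq = ∑-cong-∈ (λ v∈ → eq _ (s≤s⁻¹ (∈-upTo⁻ v∈)))

  ∑≤-snoc : ∀ m f → ∑≤ (suc m) f ≈ ∑≤ m f + f (suc m)
  ∑≤-snoc m f = begin
    ∑ (upTo (suc (suc m))) f           ≡⟨ ≡.cong (λ vs → ∑ vs f) (≡.sym (List.upTo-∷ʳ (suc m))) ⟩
    ∑ (upTo (suc m) ++ suc m ∷ []) f   ≈⟨ ∑-++ (upTo (suc m)) _ f ⟩
    ∑≤ m f + (f (suc m) + 0#)          ≈⟨ +-congˡ (+-identityʳ _) ⟩
    ∑≤ m f + f (suc m)                 ∎

  ∑≤-reverse : ∀ m f → ∑≤ m f ≈ ∑[ i ≤ m ] f (m ∸ i)
  ∑≤-reverse zero    f = refl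
  ∑≤-reverse (suc m) f = begin
    ∑≤ (suc m) f                          ≈⟨ ∑≤-snoc m f ⟩
    ∑≤ m f + f (suc m)                    ≈⟨ +-congʳ (∑≤-reverse m f) ⟩
    ∑[ i ≤ m ] f (m ∸ i) + f (suc m)      ≈⟨ +-comm _ _ ⟩
    f (suc m) + ∑[ i ≤ m ] f (m ∸ i)      ≡⟨ ≡.sym (∑≤-suc m (λ i → f (suc m ∸ i))) ⟩
    ∑[ i ≤ suc m ] f (suc m ∸ i)          ∎

  ∑≤-from : ∀ ℓ m (F : ℕ → Carrier) → ℓ ≤ m →
            ∑[ v ≤ m ] when (ℓ ≤ᵇ v) (F v) ≈ ∑[ j ≤ m ∸ ℓ ] F (ℓ ℕ.+ j)
  ∑≤-from zero    m       F _         = refl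
  ∑≤-from (suc ℓ) (suc m) F (s≤s ℓ≤m) = begin
    ∑≤ (suc m) (λ v → when (suc ℓ ≤ᵇ v) (F v))        ≡⟨ ∑≤-suc m _ ⟩
    0# + ∑[ v ≤ m ] when (ℓ <ᵇ suc v) (F (suc v))      ≈⟨ +-identityˡ _ ⟩
    ∑[ v ≤ m ] when (ℓ <ᵇ suc v) (F (suc v))
      ≈⟨ ∑-cong (upTo (suc m)) (λ v → reflexive (≡.cong (λ b → when b (F (suc v))) (<ᵇ-suc ℓ v))) ⟩
    ∑[ v ≤ m ] when (ℓ ≤ᵇ v) (F (suc v))               ≈⟨ ∑≤-from ℓ m (F ∘ suc) ℓ≤m ⟩
    ∑[ j ≤ m ∸ ℓ ] F (suc ℓ ℕ.+ j)                     ∎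

  ∑≤-none : ∀ m (F : ℕ → Carrier) → ∑[ v ≤ m ] when (suc m ≤ᵇ v) (F v) ≈ 0#
  ∑≤-none m F =
    trans (∑≤-cong-≤ m λ v v≤m → reflexive (≡.cong (λ b → when b (F v)) (≤⇒suc≰ᵇ v≤m)))
          (∑-0# (upTo (suc m)))

-- Laurent polynomials in X form a commutative semiring

open import Data.Integer using (+_)

module ℤ∑ = FiniteSum ℤP.+-*-commutativeSemiring

coeffOf : ℤ → ℤ × ℤ → ℤ
coeffOf e t = ℤ∑.when (does (proj₁ t ℤ.≟ e)) (proj₂ t)

shiftBy : ℤ × ℤ → ℤ × ℤ → ℤ × ℤ
shiftBy t s = (proj₁ t ℤ.+ proj₁ s , proj₂ t ℤ.* proj₂ s)

coeff-∑ : ∀ p e → coeffL p e ≡ ℤ∑.∑ p (coeffOf e)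
coeff-∑ []      e = ≡.refl
coeff-∑ (t ∷ p) e = ≡.cong (ℤ._+_ (coeffOf e t)) (coeff-∑ p e)

coeff-++ : ∀ p q e → coeffL (p ++ q) e ≡ coeffL p e ℤ.+ coeffL q e
coeff-++ p q e = ≡.trans (coeff-∑ (p ++ q) e)
  (≡.trans (ℤ∑.∑-++ p q (coeffOf e)) (≡.sym (≡.cong₂ ℤ._+_ (coeff-∑ p e) (coeff-∑ q e))))

≟-transpose : ∀ a b e → does (a ℤ.+ b ℤ.≟ e) ≡ does (b ℤ.≟ e - a)
≟-transpose a b e = does-⇔ (mk⇔ (λ eq → ≡.trans (b≡a+b-a a b) (≡.cong (_- a) eq))
                                (λ eq → ≡.trans (≡.cong (ℤ._+_ a) eq) (a+[e-a]≡e a e)))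
                           (a ℤ.+ b ℤ.≟ e) (b ℤ.≟ e - a)
  where
  b≡a+b-a : ∀ a b → b ≡ (a ℤ.+ b) - a
  b≡a+b-a = solve-∀
  a+[e-a]≡e : ∀ a e → a ℤ.+ (e - a) ≡ e
  a+[e-a]≡e = solve-∀

coeff-shiftBy : ∀ t q e → coeffL (map (shiftBy t) q) e ≡ proj₂ t ℤ.* coeffL q (e - proj₁ t)
coeff-shiftBy t []      e = ≡.sym (ℤP.*-zeroʳ (proj₂ t))
coeff-shiftBy t (s ∷ q) e = ≡.trans
  (≡.cong₂ ℤ._+_ (≡.trans (≡.cong (λ b → ℤ∑.when b _) (≟-transpose (proj₁ t) (proj₁ s) e))
                          (≡.sym (ℤ∑.when-*ʳ _ (proj₂ t) (proj₂ s))))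
                 (coeff-shiftBy t q e))
  (≡.sym (ℤP.*-distribˡ-+ (proj₂ t) _ _))

coeff-* : ∀ p q e → coeffL (p *L q) e ≡ ℤ∑.∑ p (λ t → proj₂ t ℤ.* coeffL q (e - proj₁ t))
coeff-* []      q e = ≡.refl
coeff-* (t ∷ p) q e = ≡.trans (coeff-++ (map (shiftBy t) q) (p *L q) e)
                              (≡.cong₂ ℤ._+_ (coeff-shiftBy t q e) (coeff-* p q e))

∑-*L : ∀ p q (f : ℤ × ℤ → ℤ) → ℤ∑.∑ (p *L q) f ≡ ℤ∑.∑ p (λ t → ℤ∑.∑ q (f ∘ shiftBy t))
∑-*L p q f = ≡.trans (ℤ∑.∑-concatMap (λ t → map (shiftBy t) q) p f)
                      (ℤ∑.∑-cong p (λ t → ℤ∑.∑-map (shiftBy t) q f))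

-- A record rather than _≈L_ itself, so that p and q can be inferred from a proof of p ≋ q.
record _≋_ (p q : LP) : Set where
  constructor mk≋
  field coeff-≡ : p ≈L q
open _≋_

≋-refl : ∀ {p} → p ≋ p
≋-refl = mk≋ λ _ → ≡.refl

≋-trans : ∀ {p q r} → p ≋ q → q ≋ r → p ≋ r
≋-trans (mk≋ p≈q) (mk≋ q≈r) = mk≋ λ e → ≡.trans (p≈q e) (q≈r e)

≋-isEquivalence : IsEquivalence _≋_
≋-isEquivalence = record
  { refl = ≋-refl ; sym = λ (mk≋ p≈q) → mk≋ λ e → ≡.sym (p≈q e) ; trans = ≋-trans }

≡⇒≋ : ∀ {p q} → p ≡ q → p ≋ q
≡⇒≋ ≡.refl = ≋-refl

+L-cong : ∀ {p p′ q q′} → p ≋ p′ → q ≋ q′ → (p +L q) ≋ (p′ +L q′)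
+L-cong {p} {p′} {q} {q′} (mk≋ p≈p′) (mk≋ q≈q′) = mk≋ λ e →
  ≡.trans (coeff-++ p q e) (≡.trans (≡.cong₂ ℤ._+_ (p≈p′ e) (q≈q′ e)) (≡.sym (coeff-++ p′ q′ e)))

+L-comm : ∀ p q → (p +L q) ≋ (q +L p)
+L-comm p q = mk≋ λ e →
  ≡.trans (coeff-++ p q e) (≡.trans (ℤP.+-comm (coeffL p e) _) (≡.sym (coeff-++ q p e)))

*L-congʳ : ∀ p {q q′} → q ≋ q′ → (p *L q) ≋ (p *L q′)
*L-congʳ p {q} {q′} (mk≋ q≈q′) = mk≋ λ e → ≡.trans (coeff-* p q e)
  (≡.trans (ℤ∑.∑-cong p (λ t → ≡.cong (proj₂ t ℤ.*_) (q≈q′ _))) (≡.sym (coeff-* p q′ e)))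

≟-swap : ∀ a b e → does (b ℤ.≟ e - a) ≡ does (a ℤ.≟ e - b)
≟-swap a b e = ≡.trans (≡.sym (≟-transpose a b e))
  (≡.trans (≡.cong (λ z → does (z ℤ.≟ e)) (ℤP.+-comm a b)) (≟-transpose b a e))

coeff-*-∑∑ : ∀ p q e → coeffL (p *L q) e ≡
             ℤ∑.∑ p (λ t → ℤ∑.∑ q (λ s → ℤ∑.when (does (proj₁ s ℤ.≟ e - proj₁ t)) (proj₂ t ℤ.* proj₂ s)))
coeff-*-∑∑ p q e = ≡.trans (coeff-* p q e) (ℤ∑.∑-cong p λ t →
  ≡.trans (≡.cong (proj₂ t ℤ.*_) (coeff-∑ q _))
  (≡.trans (ℤ∑.*-distribˡ-∑ (proj₂ t) q _) (ℤ∑.∑-cong q λ s → ℤ∑.when-*ʳ _ (proj₂ t) (proj₂ s))))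

*L-comm : ∀ p q → (p *L q) ≋ (q *L p)
*L-comm p q = mk≋ λ e → ≡.trans (coeff-*-∑∑ p q e) (≡.trans
  (ℤ∑.∑-cong p (λ t → ℤ∑.∑-cong q (λ s →
    ≡.cong₂ ℤ∑.when (≟-swap (proj₁ t) (proj₁ s) e) (ℤP.*-comm (proj₂ t) (proj₂ s)))))
  (≡.trans (ℤ∑.∑-comm p q _) (≡.sym (coeff-*-∑∑ q p e))))

*L-cong : ∀ {p p′ q q′} → p ≋ p′ → q ≋ q′ → (p *L q) ≋ (p′ *L q′)
*L-cong {p} {p′} {q} {q′} p≋p′ q≋q′ =
  ≋-trans (*L-comm p q) (≋-trans (*L-congʳ q p≋p′) (≋-trans (*L-comm q p′) (*L-congʳ p′ q≋q′)))

*L-assoc : ∀ p q r → ((p *L q) *L r) ≋ (p *L (q *L r))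
*L-assoc p q r = mk≋ λ e → ≡.trans (coeff-* (p *L q) r e) (≡.trans (∑-*L p q _)
  (≡.trans (ℤ∑.∑-cong p λ t → ≡.trans (ℤ∑.∑-cong q λ s → reassoc e t s)
                                      (≡.sym (≡.trans (≡.cong (proj₂ t ℤ.*_) (coeff-* q r _))
                                                      (ℤ∑.*-distribˡ-∑ (proj₂ t) q _))))
           (≡.sym (coeff-* p (q *L r) e))))
  where
  e-[a+b]≡e-a-b : ∀ a b e → e - (a ℤ.+ b) ≡ (e - a) - b
  e-[a+b]≡e-a-b = solve-∀
  reassoc : ∀ e t s → (proj₂ t ℤ.* proj₂ s) ℤ.* coeffL r (e - (proj₁ t ℤ.+ proj₁ s))
                    ≡ proj₂ t ℤ.* (proj₂ s ℤ.* coeffL r ((e - proj₁ t) - proj₁ s))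
  reassoc e t s = ≡.trans (ℤP.*-assoc (proj₂ t) (proj₂ s) _)
    (≡.cong (λ z → proj₂ t ℤ.* (proj₂ s ℤ.* coeffL r z)) (e-[a+b]≡e-a-b (proj₁ t) (proj₁ s) e))

*L-identityˡ : ∀ p → (mon (+ 1) (+ 0) *L p) ≋ p
*L-identityˡ p = mk≋ λ e → ≡.trans (coeff-* (mon (+ 1) (+ 0)) p e)
  (≡.trans (ℤP.+-identityʳ _) (≡.trans (ℤP.*-identityˡ _) (≡.cong (coeffL p) (ℤP.+-identityʳ e))))

*L-distribʳ : ∀ r p q → ((p +L q) *L r) ≋ ((p *L r) +L (q *L r))
*L-distribʳ r p q = mk≋ λ e → ≡.trans (coeff-* (p ++ q) r e)
  (≡.trans (ℤ∑.∑-++ p q _)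
  (≡.sym (≡.trans (coeff-++ (p *L r) (q *L r) e) (≡.cong₂ ℤ._+_ (coeff-* p r e) (coeff-* q r e)))))

LP-commutativeSemiring : CommutativeSemiring 0ℓ 0ℓ
LP-commutativeSemiring = record
  { Carrier = LP
  ; _≈_ = _≋_
  ; _+_ = _+L_
  ; _*_ = _*L_
  ; 0# = 0L
  ; 1# = mon (+ 1) (+ 0)
  ; isCommutativeSemiring = isCommutativeSemiringˡ record
    { +-isCommutativeMonoid = record
      { isMonoid = record
        { isSemigroup = record
          { isMagma = record { isEquivalence = ≋-isEquivalence ; ∙-cong = +L-cong }
          ; assoc = λ p q r → ≡⇒≋ (List.++-assoc p q r) }
        ; identity = (λ _ → ≋-refl) , λ p → ≡⇒≋ (List.++-identityʳ p) }
      ; comm = +L-comm }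
    ; *-isCommutativeMonoid = record
      { isMonoid = record
        { isSemigroup = record
          { isMagma = record { isEquivalence = ≋-isEquivalence ; ∙-cong = *L-cong }
          ; assoc = *L-assoc }
        ; identity = *L-identityˡ , λ p → ≋-trans (*L-comm p _) (*L-identityˡ p) }
      ; comm = *L-comm }
    ; distribʳ = *L-distribʳ
    ; zeroˡ = λ _ → ≋-refl
    }
  }

open CommutativeSemiring LP-commutativeSemiring
open FiniteSum LP-commutativeSemiring
open import Relation.Binary.Reasoning.Setoid setoid
open import Algebra.Properties.CommutativeSemigroup *-commutativeSemigroup using (x∙yz≈y∙xz; interchange)

shiftY-cong : ∀ {S S′ : Series} d → (∀ k → S k ≈ S′ k) → ∀ j → shiftY d S j ≈ shiftY d S′ j
shiftY-cong zero    S≈S′ j       = S≈S′ j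
shiftY-cong (suc d) S≈S′ zero    = refl
shiftY-cong (suc d) S≈S′ (suc j) = shiftY-cong d S≈S′ j

shiftY-scaleS : ∀ d c S j → shiftY d (scaleS c S) j ≈ c * shiftY d S j
shiftY-scaleS zero    c S j       = refl
shiftY-scaleS (suc d) c S zero    = sym (zeroʳ c)
shiftY-scaleS (suc d) c S (suc j) = shiftY-scaleS d c S j

conv-shiftYˡ : ∀ d S G k → conv (shiftY d S) G k ≡ shiftY d (conv S G) k
conv-shiftYˡ zero    S G k       = ≡.refl
conv-shiftYˡ (suc d) S G zero    = ≡.refl
conv-shiftYˡ (suc d) S G (suc k) = conv-shiftYˡ d S G k

conv-∑ : ∀ F G k → conv F G k ≈ ∑[ i ≤ k ] (F i * G (k ∸ i))
conv-∑ F G zero    = sym (+-identityʳ _)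
conv-∑ F G (suc k) = begin
  F 0 * G (suc k) + conv (F ∘ suc) G k                  ≈⟨ +-congˡ (conv-∑ (F ∘ suc) G k) ⟩
  F 0 * G (suc k) + ∑[ i ≤ k ] (F (suc i) * G (k ∸ i))   ≡⟨ ≡.sym (∑≤-suc k (λ i → F i * G (suc k ∸ i))) ⟩
  ∑[ i ≤ suc k ] (F i * G (suc k ∸ i))                  ∎

conv-comm : ∀ F G k → conv F G k ≈ conv G F k
conv-comm F G k = begin
  conv F G k                                  ≈⟨ conv-∑ F G k ⟩
  ∑[ i ≤ k ] (F i * G (k ∸ i))                ≈⟨ ∑≤-reverse k _ ⟩
  ∑[ i ≤ k ] (F (k ∸ i) * G (k ∸ (k ∸ i)))    ≈⟨ ∑≤-cong-≤ k (λ i i≤k → trans (*-comm (F (k ∸ i)) _)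
                                                   (reflexive (≡.cong (λ j → G j * F (k ∸ i)) (ℕP.m∸[m∸n]≡n i≤k)))) ⟩
  ∑[ i ≤ k ] (G i * F (k ∸ i))                ≈⟨ sym (conv-∑ G F k) ⟩
  conv G F k                                  ∎

DesAfter : Letter → CPerm → List ℕ
DesAfter p a = descsFrom 0 (p ∷ a)

desAfter : Letter → CPerm → ℕ
desAfter p a = length (DesAfter p a)

comajAfter : Letter → CPerm → ℕ
comajAfter p a = foldr (λ i s → (length a ∸ i) ℕ.+ s) 0 (DesAfter p a)

-- A letter of colour γ lies below (0 , 0) iff γ ≠ 0, so a virtual first letter (0 , 0)
-- contributes the descent 0 exactly when Des does.
Des≡DesAfter⁰ : ∀ a → Des a ≡ DesAfter (0 , 0) a
Des≡DesAfter⁰ []                = ≡.refl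
Des≡DesAfter⁰ ((σ , zero) ∷ a)  = ≡.refl
Des≡DesAfter⁰ ((σ , suc γ) ∷ a) = ≡.refl

addIf : Bool → ℕ → ℕ → ℕ
addIf b k n = if b then k ℕ.+ n else n

descsFrom-suc : ∀ i w → descsFrom (suc i) w ≡ map suc (descsFrom i w)
descsFrom-suc i []          = ≡.refl
descsFrom-suc i (x ∷ [])    = ≡.refl
descsFrom-suc i (x ∷ y ∷ w) =
  ≡.trans (≡.cong₂ _++_ (head-suc (y <C x)) (descsFrom-suc (suc i) (y ∷ w)))
          (≡.sym (List.map-++ suc (if y <C x then i ∷ [] else []) _))
  where
  head-suc : ∀ b → (if b then suc i ∷ [] else []) ≡ map suc (if b then i ∷ [] else [])
  head-suc true  = ≡.refl
  head-suc false = ≡.refl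

length-descsFrom-suc : ∀ i w → length (descsFrom (suc i) w) ≡ length (descsFrom i w)
length-descsFrom-suc i w =
  ≡.trans (≡.cong length (descsFrom-suc i w)) (List.length-map suc (descsFrom i w))

comaj-descsFrom-suc : ∀ n i w → foldr (λ j s → (suc n ∸ j) ℕ.+ s) 0 (descsFrom (suc i) w)
                                ≡ foldr (λ j s → (n ∸ j) ℕ.+ s) 0 (descsFrom i w)
comaj-descsFrom-suc n i w =
  ≡.trans (≡.cong (foldr _ 0) (descsFrom-suc i w)) (List.foldr-map _ suc 0 (descsFrom i w))

desAfter-∷ : ∀ p x a → desAfter p (x ∷ a) ≡ addIf (x <C p) 1 (desAfter x a)
desAfter-∷ p x a with x <C p
... | true  = ≡.cong suc (length-descsFrom-suc 0 (x ∷ a))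
... | false = length-descsFrom-suc 0 (x ∷ a)

comajAfter-∷ : ∀ p x a → comajAfter p (x ∷ a) ≡ addIf (x <C p) (suc (length a)) (comajAfter x a)
comajAfter-∷ p x a with x <C p
... | true  = ≡.cong (suc (length a) ℕ.+_) (comaj-descsFrom-suc (length a) 0 (x ∷ a))
... | false = comaj-descsFrom-suc (length a) 0 (x ∷ a)

-- The colour order and P-partitions

_≺_ : Letter → Letter → Set
(σ₁ , γ₁) ≺ (σ₂ , γ₂) = (γ₁ ≡ γ₂ × σ₁ < σ₂) ⊎ γ₂ < γ₁

_≺?_ : Decidable _≺_
(σ₁ , γ₁) ≺? (σ₂ , γ₂) = ((σ₁ , γ₁) <C (σ₂ , γ₂)) because
  ((fromEquivalence (ℕP.≡ᵇ⇒≡ γ₁ γ₂) (ℕP.≡⇒≡ᵇ γ₁ γ₂) ×-reflects ℕP.<ᵇ-reflects-< σ₁ σ₂)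
   ⊎-reflects ℕP.<ᵇ-reflects-< γ₂ γ₁)

≺-asym : ∀ {x y} → x ≺ y → ¬ y ≺ x
≺-asym (inj₁ (_ , σ<τ)) (inj₁ (_ , τ<σ)) = ℕP.<-asym σ<τ τ<σ
≺-asym (inj₁ (γ≡δ , _)) (inj₂ γ<δ)       = ℕP.<-irrefl γ≡δ γ<δ
≺-asym (inj₂ δ<γ)       (inj₁ (δ≡γ , _)) = ℕP.<-irrefl δ≡γ δ<γ
≺-asym (inj₂ δ<γ)       (inj₂ γ<δ)       = ℕP.<-asym δ<γ γ<δ

≺-connex : ∀ {x y} → proj₁ x ≢ proj₁ y → x ≺ y ⊎ y ≺ x
≺-connex {σ , γ} {τ , δ} σ≢τ with ℕP.<-cmp γ δ | ℕP.<-cmp σ τ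
... | tri< γ<δ _ _ | _            = inj₂ (inj₂ γ<δ)
... | tri> _ _ δ<γ | _            = inj₁ (inj₂ δ<γ)
... | tri≈ _ γ≡δ _ | tri< σ<τ _ _ = inj₁ (inj₁ (γ≡δ , σ<τ))
... | tri≈ _ γ≡δ _ | tri≈ _ σ≡τ _ = ⊥-elim (σ≢τ σ≡τ)
... | tri≈ _ γ≡δ _ | tri> _ _ τ<σ = inj₂ (inj₁ (≡.sym γ≡δ , τ<σ))

≺-cotrans : ∀ {p x y} → y ≺ p → y ≺ x ⊎ x ≺ p
≺-cotrans {σp , γp} {σx , γx} {σy , γy} y≺p with ℕP.<-cmp γx γy
... | tri< γx<γy _ _ = inj₁ (inj₂ γx<γy)
... | tri> _ _ γy<γx = inj₂ (inj₂ (γp<γy⇒γp<γx y≺p))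
  where
  γp<γy⇒γp<γx : (σy , γy) ≺ (σp , γp) → γp < γx
  γp<γy⇒γp<γx (inj₁ (γy≡γp , _)) = ≡.subst (_< γx) γy≡γp γy<γx
  γp<γy⇒γp<γx (inj₂ γp<γy)       = ℕP.<-trans γp<γy γy<γx
... | tri≈ _ γx≡γy _ with y≺p
...   | inj₂ γp<γy = inj₂ (inj₂ (≡.subst (γp <_) (≡.sym γx≡γy) γp<γy))
...   | inj₁ (γy≡γp , σy<σp) with σy <? σx
...     | yes σy<σx = inj₁ (inj₁ (≡.sym γx≡γy , σy<σx))
...     | no σy≮σx  = inj₂ (inj₁ (≡.trans γx≡γy γy≡γp , ℕP.≤-<-trans (ℕP.≮⇒≥ σy≮σx) σy<σp))

<C-flip : ∀ x y → proj₁ x ≢ proj₁ y → y <C x ≡ not (x <C y)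
<C-flip x y x≢y with ≺-connex {x} {y} x≢y
... | inj₁ x≺y = ≡.trans (dec-false (y ≺? x) (≺-asym x≺y)) (≡.cong not (≡.sym (dec-true (x ≺? y) x≺y)))
... | inj₂ y≺x = ≡.trans (dec-true (y ≺? x) y≺x) (≡.cong not (≡.sym (dec-false (x ≺? y) (≺-asym y≺x))))

T-does⇔ : ∀ {a} {A : Set a} (a? : Dec A) → T (does a?) ⇔ A
T-does⇔ (yes a) = mk⇔ (λ _ → a) (λ _ → _)
T-does⇔ (no ¬a) = mk⇔ (λ ()) ¬a

<C-cotrans : ∀ p x y → T (y <C p) → T (y <C x) ⊎ T (x <C p)
<C-cotrans p x y y<p =
  Sum.map (Equivalence.from (T-does⇔ (y ≺? x))) (Equivalence.from (T-does⇔ (x ≺? p)))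
          (≺-cotrans {p} {x} {y} (Equivalence.to (T-does⇔ (y ≺? p)) y<p))

n≤addIf : ∀ b k n → n ≤ addIf b k n
n≤addIf true  k n = ℕP.m≤n+m n k
n≤addIf false k n = ℕP.≤-refl

addIf-trans : ∀ b₁ b₂ b₃ {ℓ v w} → (T b₃ → T b₂ ⊎ T b₁) →
              addIf b₁ 1 ℓ ≤ v → addIf b₂ 1 v ≤ w → addIf b₃ 1 ℓ ≤ w
addIf-trans b₁     b₂     false _ ℓ≤v v≤w =
  ℕP.≤-trans (ℕP.≤-trans (n≤addIf b₁ 1 _) ℓ≤v) (ℕP.≤-trans (n≤addIf b₂ 1 _) v≤w)
addIf-trans true   b₂     true  _ ℓ<v v≤w = ℕP.≤-trans ℓ<v (ℕP.≤-trans (n≤addIf b₂ 1 _) v≤w)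
addIf-trans false  true   true  _ ℓ≤v v<w = ℕP.≤-trans (s≤s ℓ≤v) v<w
addIf-trans false  false  true  b₃⇒ _ _ with b₃⇒ _
... | inj₁ ()
... | inj₂ ()

<ᵇ-flip : ∀ m n → (m <ᵇ n) ≡ not (n ≤ᵇ m)
<ᵇ-flip m       zero    = ≡.refl
<ᵇ-flip zero    (suc n) = ≡.refl
<ᵇ-flip (suc m) (suc n) = ≡.trans (<ᵇ-flip m n) (≡.cong not (≡.sym (<ᵇ-suc n m)))

addIf-flip : ∀ b v w → (addIf b 1 w ≤ᵇ v) ≡ not (addIf (not b) 1 v ≤ᵇ w)
addIf-flip true  v w = <ᵇ-flip w v
addIf-flip false v w =
  ≡.sym (≡.trans (≡.cong not (<ᵇ-flip v w)) (Bool.not-involutive (w ≤ᵇ v)))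

-- The values of a P-partition of a coloured word weakly increase along the word and
-- strictly at each descent: (ℓ , p) ⊑ (v , x) says that x may take the value v right after p
-- took the value ℓ.
_⊑_ : ℕ × Letter → ℕ × Letter → Bool
(ℓ , p) ⊑ (v , x) = addIf (x <C p) 1 ℓ ≤ᵇ v

⊑-trans : ∀ κ v x w y → T (κ ⊑ (v , x)) → T ((v , x) ⊑ (w , y)) → T (κ ⊑ (w , y))
⊑-trans (ℓ , p) v x w y κ⊑vx vx⊑wy = ℕP.≤⇒≤ᵇ
  (addIf-trans (x <C p) (y <C x) (y <C p) (<C-cotrans p x y)
               (ℕP.≤ᵇ⇒≤ _ v κ⊑vx) (ℕP.≤ᵇ⇒≤ _ w vx⊑wy))

⊑-flip : ∀ v x w y → proj₁ x ≢ proj₁ y → (w , y) ⊑ (v , x) ≡ not ((v , x) ⊑ (w , y))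
⊑-flip v x w y x≢y = ≡.trans (addIf-flip (x <C y) v w)
  (≡.cong (λ b → not (addIf b 1 v ≤ᵇ w)) (≡.sym (<C-flip x y x≢y)))

*U-assoc : ∀ u v w → (u *U v) *U w ≡ u *U (v *U w)
*U-assoc u v w = ≡.cong₂ ±X^ (Bool.xor-assoc (negative u) _ _) (ℤP.+-assoc (expo u) _ _)

*U-comm : ∀ u v → u *U v ≡ v *U u
*U-comm u v = ≡.cong₂ ±X^ (Bool.xor-comm (negative u) _) (ℤP.+-comm (expo u) _)

*U-identityˡ : ∀ u → oneU *U u ≡ u
*U-identityˡ u = ≡.cong (±X^ (negative u)) (ℤP.+-identityˡ (expo u))

*U-identityʳ : ∀ u → u *U oneU ≡ u
*U-identityʳ u = ≡.trans (*U-comm u oneU) (*U-identityˡ u)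

*U-leftComm : ∀ u v w → u *U (v *U w) ≡ v *U (u *U w)
*U-leftComm u v w = ≡.trans (≡.sym (*U-assoc u v w))
  (≡.trans (≡.cong (_*U w) (*U-comm u v)) (*U-assoc v u w))

toLP-*U : ∀ u v → toLP (u *U v) ≡ toLP u * toLP v
toLP-*U (±X^ false e) (±X^ false f) = ≡.refl
toLP-*U (±X^ false e) (±X^ true  f) = ≡.refl
toLP-*U (±X^ true  e) (±X^ false f) = ≡.refl
toLP-*U (±X^ true  e) (±X^ true  f) = ≡.refl

_≟U_ : DecidableEquality U
±X^ s e ≟U ±X^ t f =
  map′ (λ (s≡t , e≡f) → ≡.cong₂ ±X^ s≡t e≡f) (λ eq → ≡.cong negative eq , ≡.cong expo eq)
       ((s Bool.≟ t) ×-dec (e ℤ.≟ f))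

evalU-cong : ∀ {α β} a → All (λ l → β (proj₂ l) ≡ α (proj₂ l)) a → evalU β a ≡ evalU α a
evalU-cong []      []         = ≡.refl
evalU-cong (l ∷ a) (eq ∷ eqs) = ≡.cong₂ _*U_ eq (evalU-cong a eqs)

evalU-shuffle : ∀ α a b → All (λ c → evalU α c ≡ evalU α a *U evalU α b) (shuffle a b)
evalU-shuffle α []      b       = ≡.sym (*U-identityˡ (evalU α b)) ∷ []
evalU-shuffle α (x ∷ a) []      = ≡.sym (*U-identityʳ (evalU α (x ∷ a))) ∷ []
evalU-shuffle α (x ∷ a) (y ∷ b) = AllP.++⁺
  (AllP.map⁺ (All.map (λ eq → ≡.trans (≡.cong (α (proj₂ x) *U_) eq) (≡.sym (*U-assoc (α (proj₂ x)) _ _)))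
                      (evalU-shuffle α a (y ∷ b))))
  (AllP.map⁺ (All.map (λ eq → ≡.trans (≡.cong (α (proj₂ y) *U_) eq)
                                       (*U-leftComm (α (proj₂ y)) (evalU α (x ∷ a)) (evalU α b)))
                      (evalU-shuffle α (x ∷ a) b)))

any-∈ : ∀ {A : Set} (p : A → Bool) {x xs} → x ∈ xs → T (p x) → any p xs ≡ true
any-∈ p x∈xs px = Equivalence.to Bool.T-≡ (any⁺ p (lose x∈xs px))

symbol-∈ : ∀ {f a x} → a ∈ f → x ∈ a → any (λ t → proj₁ x ≡ᵇ t) (symbolsC f) ≡ true
symbol-∈ {x = x} a∈f x∈a =
  any-∈ _ (∈-concatMap⁺ symbols (lose a∈f (∈-map⁺ proj₁ x∈a))) (ℕP.≡⇒≡ᵇ (proj₁ x) _ ≡.refl)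

colour-∈ : ∀ {f a σ c} → a ∈ f → (σ , suc c) ∈ a → inPal* (suc c) f ≡ true
colour-∈ {c = c} a∈f l∈a =
  any-∈ _ a∈f (Equivalence.from Bool.T-≡ (any-∈ _ l∈a (ℕP.≡⇒≡ᵇ (suc c) _ ≡.refl)))

SymbolDisjoint : CPerm → CPerm → Set
SymbolDisjoint a b = All (λ x → All (λ y → proj₁ x ≢ proj₁ y) b) a

Disjoint⇒SymbolDisjoint : ∀ f g {a b} → Disjoint f g → a ∈ f → b ∈ g → SymbolDisjoint a b
Disjoint⇒SymbolDisjoint f g disj a∈f b∈g = All.tabulate λ {x} x∈a → All.tabulate λ y∈b x≡y →
  disj (proj₁ x) (symbol-∈ a∈f x∈a)
       (≡.subst (λ s → any (λ t → s ≡ᵇ t) (symbolsC g) ≡ true) (≡.sym x≡y) (symbol-∈ b∈g y∈b))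

label0≡oneU : ∀ {f α} → LabelledConfig f α → α 0 ≡ oneU
label0≡oneU {α = α} (_ , supp⊆Pal*) with α 0 ≟U oneU
... | yes α0≡1 = α0≡1
... | no α0≢1 with () ← supp⊆Pal* 0 α0≢1

∪L-agreesˡ : ∀ f α g β → LabelledConfig f α → ∀ {a} → a ∈ f →
             evalU ((f , α) ∪L (g , β)) a ≡ evalU α a
∪L-agreesˡ f α g β lf {a} a∈f = evalU-cong a (All.tabulate agree)
  where
  agree : ∀ {l} → l ∈ a → ((f , α) ∪L (g , β)) (proj₂ l) ≡ α (proj₂ l)
  agree {σ , zero}  _   = ≡.sym (label0≡oneU lf)
  agree {σ , suc c} l∈a rewrite colour-∈ a∈f l∈a = ≡.refl

∪L-agreesʳ : ∀ f α g β → LabelledConfig g β → Coherent f α g β → ∀ {b} → b ∈ g →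
             evalU ((f , α) ∪L (g , β)) b ≡ evalU β b
∪L-agreesʳ f α g β lg (_ , coherent) {b} b∈g = evalU-cong b (All.tabulate agree)
  where
  agree : ∀ {l} → l ∈ b → ((f , α) ∪L (g , β)) (proj₂ l) ≡ β (proj₂ l)
  agree {σ , zero}  _ = ≡.sym (label0≡oneU lg)
  agree {σ , suc c} l∈b with inPal* (suc c) f in c∈f
  ... | true  = coherent (suc c) c∈f (colour-∈ b∈g l∈b)
  ... | false rewrite colour-∈ b∈g l∈b = ≡.refl

module PartitionSums (ε : ℤ) (m : ℕ) where

  q^_ : ℕ → LP
  q^ k = mon (+ 1) (ε ℤ.* + k)

  q^-+ : ∀ j k → q^ j * q^ k ≡ q^ (j ℕ.+ k)
  q^-+ j k = ≡.cong (λ e → (e , + 1) ∷ [])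
    (≡.trans (≡.sym (ℤP.*-distribˡ-+ ε (+ j) (+ k))) (≡.cong (ε ℤ.*_) (≡.sym (ℤP.pos-+ j k))))

  geom≡q^ : ∀ N j → geom (ε ℤ.* + N) j ≡ q^ (N ℕ.* j)
  geom≡q^ N j = ≡.cong (λ e → (e , + 1) ∷ [])
    (≡.trans (ℤP.*-assoc ε (+ N) (+ j)) (≡.cong (ε ℤ.*_) (≡.sym (ℤP.pos-* N j))))

  -- partitionSum (ℓ , p) a sums q^(v₁ + ⋯ + vₙ) over the values v₁ … vₙ ≤ m that the letters of a
  -- may successively take after the letter p took the value ℓ.
  partitionSum : ℕ × Letter → CPerm → LP
  partitionSum κ []      = 1#
  partitionSum κ (x ∷ a) = ∑[ v ≤ m ] when (κ ⊑ (v , x)) (q^ v * partitionSum (v , x) a)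

  -- The coefficient of Y^(m ∸ ℓ) in Y^d q^(nℓ + c) / ((1 - Y)(1 - qY)⋯(1 - qⁿY)), where q = X^ε.
  closedForm : (n d c ℓ : ℕ) → LP
  closedForm n d c ℓ = shiftY d (scaleS (q^ (n ℕ.* ℓ ℕ.+ c)) (invDenom ε n)) (m ∸ ℓ)

  ∑-closedForm : ∀ n d c {ℓ} → ℓ ≤ m →
    ∑[ v ≤ m ] when (ℓ ≤ᵇ v) (q^ v * closedForm n d c v) ≈ closedForm (suc n) d c ℓ
  ∑-closedForm n d c {ℓ} ℓ≤m = begin
    ∑[ v ≤ m ] when (ℓ ≤ᵇ v) (q^ v * closedForm n d c v)
      ≈⟨ ∑≤-from ℓ m (λ v → q^ v * closedForm n d c v) ℓ≤m ⟩
    ∑[ j ≤ K ] (q^ (ℓ ℕ.+ j) * closedForm n d c (ℓ ℕ.+ j))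
      ≈⟨ ∑-cong (upTo (suc K)) summand ⟩
    ∑[ j ≤ K ] (q^ (N ℕ.* ℓ ℕ.+ c) * (G j * S (K ∸ j)))
      ≈⟨ sym (*-distribˡ-∑ (q^ (N ℕ.* ℓ ℕ.+ c)) (upTo (suc K)) (λ j → G j * S (K ∸ j))) ⟩
    q^ (N ℕ.* ℓ ℕ.+ c) * ∑[ j ≤ K ] (G j * S (K ∸ j))
      ≈⟨ *-congˡ {q^ (N ℕ.* ℓ ℕ.+ c)} (trans (sym (conv-∑ G S K)) (conv-comm G S K)) ⟩
    q^ (N ℕ.* ℓ ℕ.+ c) * conv S G K
      ≡⟨ ≡.cong (q^ (N ℕ.* ℓ ℕ.+ c) *_) (conv-shiftYˡ d (invDenom ε n) G K) ⟩
    q^ (N ℕ.* ℓ ℕ.+ c) * shiftY d (invDenom ε N) K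
      ≈⟨ sym (shiftY-scaleS d (q^ (N ℕ.* ℓ ℕ.+ c)) (invDenom ε N) K) ⟩
    closedForm N d c ℓ ∎
    where
    N = suc n
    K = m ∸ ℓ
    G = geom (ε ℤ.* + N)
    S = shiftY d (invDenom ε n)
    exponent : ∀ n ℓ j c → (ℓ ℕ.+ j) ℕ.+ (n ℕ.* (ℓ ℕ.+ j) ℕ.+ c) ≡ (suc n ℕ.* ℓ ℕ.+ c) ℕ.+ suc n ℕ.* j
    exponent = ℕ-Solver.solve-∀
    summand : ∀ j → q^ (ℓ ℕ.+ j) * closedForm n d c (ℓ ℕ.+ j) ≈ q^ (N ℕ.* ℓ ℕ.+ c) * (G j * S (K ∸ j))
    summand j = begin
      q^ (ℓ ℕ.+ j) * closedForm n d c (ℓ ℕ.+ j)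
        ≈⟨ *-congˡ {q^ (ℓ ℕ.+ j)} (shiftY-scaleS d (q^ e) (invDenom ε n) (m ∸ (ℓ ℕ.+ j))) ⟩
      q^ (ℓ ℕ.+ j) * (q^ e * S (m ∸ (ℓ ℕ.+ j)))
        ≈⟨ sym (*-assoc (q^ (ℓ ℕ.+ j)) (q^ e) (S (m ∸ (ℓ ℕ.+ j)))) ⟩
      (q^ (ℓ ℕ.+ j) * q^ e) * S (m ∸ (ℓ ℕ.+ j))
        ≡⟨ ≡.cong₂ (λ e k → e * S k)
             (≡.trans (q^-+ (ℓ ℕ.+ j) _) (≡.trans (≡.cong q^_ (exponent n ℓ j c))
                                                (≡.sym (q^-+ (N ℕ.* ℓ ℕ.+ c) (N ℕ.* j)))))
             (≡.sym (ℕP.∸-+-assoc m ℓ j)) ⟩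
      (q^ (N ℕ.* ℓ ℕ.+ c) * q^ (N ℕ.* j)) * S (K ∸ j)
        ≈⟨ *-assoc (q^ (N ℕ.* ℓ ℕ.+ c)) (q^ (N ℕ.* j)) (S (K ∸ j)) ⟩
      q^ (N ℕ.* ℓ ℕ.+ c) * (q^ (N ℕ.* j) * S (K ∸ j))
        ≡⟨ ≡.cong (λ g → q^ (N ℕ.* ℓ ℕ.+ c) * (g * S (K ∸ j))) (≡.sym (geom≡q^ N j)) ⟩
      q^ (N ℕ.* ℓ ℕ.+ c) * (G j * S (K ∸ j)) ∎
      where e = n ℕ.* (ℓ ℕ.+ j) ℕ.+ c

  closedForm-suc : ∀ N d c {ℓ} → ℓ < m → closedForm N d c (suc ℓ) ≡ closedForm N (suc d) (N ℕ.+ c) ℓ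
  closedForm-suc N d c {ℓ} ℓ<m =
    ≡.cong₂ (λ e k → shiftY (suc d) (scaleS (q^ e) (invDenom ε N)) k)
            (exponent N ℓ c) (≡.sym (ℕP.+-∸-assoc 1 ℓ<m))
    where
    exponent : ∀ N ℓ c → N ℕ.* suc ℓ ℕ.+ c ≡ N ℕ.* ℓ ℕ.+ (N ℕ.+ c)
    exponent = ℕ-Solver.solve-∀

  ∑-closedForm-addIf : ∀ b n d c {ℓ} → ℓ ≤ m →
    ∑[ v ≤ m ] when (addIf b 1 ℓ ≤ᵇ v) (q^ v * closedForm n d c v)
      ≈ closedForm (suc n) (addIf b 1 d) (addIf b (suc n) c) ℓ
  ∑-closedForm-addIf false n d c ℓ≤m = ∑-closedForm n d c ℓ≤m
  ∑-closedForm-addIf true  n d c ℓ≤m with ℕP.m≤n⇒m<n∨m≡n ℓ≤m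
  ... | inj₁ ℓ<m    = trans (∑-closedForm n d c ℓ<m) (reflexive (closedForm-suc (suc n) d c ℓ<m))
  ... | inj₂ ≡.refl = trans (∑≤-none m _)
    (reflexive (≡.cong (shiftY (suc d) (scaleS (q^ _) (invDenom ε (suc n)))) (≡.sym (ℕP.n∸n≡0 m))))

  partitionSum-closedForm : ∀ a p ℓ → ℓ ≤ m →
    partitionSum (ℓ , p) a ≈ closedForm (length a) (desAfter p a) (comajAfter p a) ℓ
  partitionSum-closedForm []      p ℓ _   = reflexive (≡.cong (λ e → (e , + 1) ∷ [])
    (≡.sym (≡.cong₂ ℤ._+_ (ℤP.*-zeroʳ ε) (ℤP.*-zeroˡ (+ (m ∸ ℓ))))))
  partitionSum-closedForm (x ∷ a) p ℓ ℓ≤m = begin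
    ∑[ v ≤ m ] when ((ℓ , p) ⊑ (v , x)) (q^ v * partitionSum (v , x) a)
      ≈⟨ ∑≤-cong-≤ m (λ v v≤m → when-cong ((ℓ , p) ⊑ (v , x))
           (*-congˡ {q^ v} (partitionSum-closedForm a x v v≤m))) ⟩
    ∑[ v ≤ m ] when (addIf (x <C p) 1 ℓ ≤ᵇ v) (q^ v * closedForm n d c v)
      ≈⟨ ∑-closedForm-addIf (x <C p) n d c ℓ≤m ⟩
    closedForm (suc n) (addIf (x <C p) 1 d) (addIf (x <C p) (suc n) c) ℓ
      ≡⟨ ≡.sym (≡.cong₂ (λ d′ c′ → closedForm (suc n) d′ c′ ℓ) (desAfter-∷ p x a) (comajAfter-∷ p x a)) ⟩
    closedForm (suc n) (desAfter p (x ∷ a)) (comajAfter p (x ∷ a)) ℓ ∎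
    where
    n = length a
    d = desAfter x a
    c = comajAfter x a

  ∑-partitionSum-∷ : ∀ κ z (S : List CPerm) (P : ℕ → LP) →
    (∀ v → ∑[ c ∈ S ] partitionSum (v , z) c ≈ P v) →
    ∑[ c ∈ S ] partitionSum κ (z ∷ c) ≈ ∑[ v ≤ m ] when (κ ⊑ (v , z)) (q^ v * P v)
  ∑-partitionSum-∷ κ z S P ∑≈P = begin
    ∑[ c ∈ S ] ∑[ v ≤ m ] when (κ ⊑ (v , z)) (q^ v * partitionSum (v , z) c)
      ≈⟨ ∑-comm S (upTo (suc m)) _ ⟩
    ∑[ v ≤ m ] ∑[ c ∈ S ] when (κ ⊑ (v , z)) (q^ v * partitionSum (v , z) c)
      ≈⟨ ∑-cong (upTo (suc m)) (λ v → trans (∑-when (κ ⊑ (v , z)) S _) (when-cong (κ ⊑ (v , z))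
           (trans (sym (*-distribˡ-∑ (q^ v) S (partitionSum (v , z)))) (*-congˡ {q^ v} (∑≈P v))))) ⟩
    ∑[ v ≤ m ] when (κ ⊑ (v , z)) (q^ v * P v) ∎

  -- A P-partition of a shuffle of x a and y b starts with x exactly when xFirst holds of the values
  -- v of x and w of y; this splits the product of the partition sums of x a and y b in two.
  module ShuffleStep (κ : ℕ × Letter) (x : Letter) (a : CPerm) (y : Letter) (b : CPerm)
                     (x≢y : proj₁ x ≢ proj₁ y) where

    φˣ φʸ : ℕ → LP
    φˣ v = q^ v * partitionSum (v , x) a
    φʸ w = q^ w * partitionSum (w , y) b

    xFirst : ℕ → ℕ → Bool
    xFirst v w = (v , x) ⊑ (w , y)

    xFirstSum yFirstSum : LP
    xFirstSum = ∑[ v ≤ m ] when (κ ⊑ (v , x)) (∑[ w ≤ m ] when (xFirst v w) (φˣ v * φʸ w))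
    yFirstSum = ∑[ w ≤ m ] when (κ ⊑ (w , y)) (∑[ v ≤ m ] when (not (xFirst v w)) (φˣ v * φʸ w))

    product-split : partitionSum κ (x ∷ a) * partitionSum κ (y ∷ b) ≈ xFirstSum + yFirstSum
    product-split = begin
      partitionSum κ (x ∷ a) * partitionSum κ (y ∷ b)
        ≈⟨ ∑-*-∑ vs vs (λ v → when (κ ⊑ (v , x)) (φˣ v)) (λ w → when (κ ⊑ (w , y)) (φʸ w)) ⟩
      ∑[ v ≤ m ] ∑[ w ≤ m ] (when (κ ⊑ (v , x)) (φˣ v) * when (κ ⊑ (w , y)) (φʸ w))
        ≈⟨ ∑-cong vs (λ v → ∑-cong vs (λ w → trans (when-*ˡ (κ ⊑ (v , x)) _ _)
             (when-cong (κ ⊑ (v , x)) (when-*ʳ (κ ⊑ (w , y)) (φˣ v) (φʸ w))))) ⟩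
      ∑[ v ≤ m ] ∑[ w ≤ m ] when (κ ⊑ (v , x)) (when (κ ⊑ (w , y)) (φˣ v * φʸ w))
        ≈⟨ ∑-cong vs (λ v → ∑-cong vs (λ w → split v w)) ⟩
      ∑[ v ≤ m ] ∑[ w ≤ m ] (X v w + Y v w)
        ≈⟨ trans (∑-cong vs (λ v → ∑-distrib-+ vs (X v) (Y v)))
                 (∑-distrib-+ vs (λ v → ∑ vs (X v)) (λ v → ∑ vs (Y v))) ⟩
      ∑[ v ≤ m ] ∑[ w ≤ m ] X v w + ∑[ v ≤ m ] ∑[ w ≤ m ] Y v w
        ≈⟨ +-cong (∑-cong vs (λ v → ∑-when (κ ⊑ (v , x)) vs _))
                  (trans (∑-comm vs vs Y) (∑-cong vs (λ w → ∑-when (κ ⊑ (w , y)) vs _))) ⟩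
      xFirstSum + yFirstSum ∎
      where
      vs = upTo (suc m)
      X Y : ℕ → ℕ → LP
      X v w = when (κ ⊑ (v , x)) (when (xFirst v w) (φˣ v * φʸ w))
      Y v w = when (κ ⊑ (w , y)) (when (not (xFirst v w)) (φˣ v * φʸ w))
      split : ∀ v w → when (κ ⊑ (v , x)) (when (κ ⊑ (w , y)) (φˣ v * φʸ w)) ≈ X v w + Y v w
      split v w = when-split (κ ⊑ (v , x)) (κ ⊑ (w , y)) (xFirst v w) _
        (⊑-trans κ v x w y)
        (λ κ⊑wy ¬xFirst → ⊑-trans κ w y v x κ⊑wy
          (≡.subst T (≡.sym (⊑-flip v x w y x≢y)) ¬xFirst))

    shuffles-from-x :
      (∀ v → partitionSum (v , x) a * partitionSum (v , x) (y ∷ b)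
               ≈ ∑[ c ∈ shuffle a (y ∷ b) ] partitionSum (v , x) c) →
      ∑[ c ∈ shuffle a (y ∷ b) ] partitionSum κ (x ∷ c) ≈ xFirstSum
    shuffles-from-x IH = trans
      (∑-partitionSum-∷ κ x (shuffle a (y ∷ b)) _ (λ v → sym (IH v)))
      (∑-cong (upTo (suc m)) λ v → when-cong (κ ⊑ (v , x)) (begin
        q^ v * (partitionSum (v , x) a * partitionSum (v , x) (y ∷ b))
          ≈⟨ sym (*-assoc (q^ v) (partitionSum (v , x) a) (partitionSum (v , x) (y ∷ b))) ⟩
        φˣ v * ∑[ w ≤ m ] when (xFirst v w) (φʸ w)
          ≈⟨ *-distribˡ-∑ (φˣ v) (upTo (suc m)) _ ⟩
        ∑[ w ≤ m ] (φˣ v * when (xFirst v w) (φʸ w))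
          ≈⟨ ∑-cong (upTo (suc m)) (λ w → when-*ʳ (xFirst v w) (φˣ v) (φʸ w)) ⟩
        ∑[ w ≤ m ] when (xFirst v w) (φˣ v * φʸ w) ∎))

    shuffles-from-y :
      (∀ w → partitionSum (w , y) (x ∷ a) * partitionSum (w , y) b
               ≈ ∑[ c ∈ shuffle (x ∷ a) b ] partitionSum (w , y) c) →
      ∑[ c ∈ shuffle (x ∷ a) b ] partitionSum κ (y ∷ c) ≈ yFirstSum
    shuffles-from-y IH = trans
      (∑-partitionSum-∷ κ y (shuffle (x ∷ a) b) _ (λ w → sym (IH w)))
      (∑-cong (upTo (suc m)) λ w → when-cong (κ ⊑ (w , y)) (begin
        q^ w * (∑[ v ≤ m ] when ((w , y) ⊑ (v , x)) (φˣ v) * partitionSum (w , y) b)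
          ≈⟨ x∙yz≈y∙xz (q^ w) (∑[ v ≤ m ] when ((w , y) ⊑ (v , x)) (φˣ v)) (partitionSum (w , y) b) ⟩
        ∑[ v ≤ m ] when ((w , y) ⊑ (v , x)) (φˣ v) * φʸ w
          ≈⟨ *-distribʳ-∑ (upTo (suc m)) (λ v → when ((w , y) ⊑ (v , x)) (φˣ v)) (φʸ w) ⟩
        ∑[ v ≤ m ] (when ((w , y) ⊑ (v , x)) (φˣ v) * φʸ w)
          ≈⟨ ∑-cong (upTo (suc m)) (λ v → trans (when-*ˡ ((w , y) ⊑ (v , x)) (φˣ v) (φʸ w))
               (reflexive (≡.cong (λ b → when b (φˣ v * φʸ w)) (⊑-flip v x w y x≢y)))) ⟩
        ∑[ v ≤ m ] when (not (xFirst v w)) (φˣ v * φʸ w) ∎))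

    partitionSum-shuffle-∷ :
      (∀ v → partitionSum (v , x) a * partitionSum (v , x) (y ∷ b)
               ≈ ∑[ c ∈ shuffle a (y ∷ b) ] partitionSum (v , x) c) →
      (∀ w → partitionSum (w , y) (x ∷ a) * partitionSum (w , y) b
               ≈ ∑[ c ∈ shuffle (x ∷ a) b ] partitionSum (w , y) c) →
      partitionSum κ (x ∷ a) * partitionSum κ (y ∷ b)
        ≈ ∑[ c ∈ shuffle (x ∷ a) (y ∷ b) ] partitionSum κ c
    partitionSum-shuffle-∷ IHˣ IHʸ = begin
      partitionSum κ (x ∷ a) * partitionSum κ (y ∷ b)
        ≈⟨ product-split ⟩
      xFirstSum + yFirstSum
        ≈⟨ sym (+-cong (shuffles-from-x IHˣ) (shuffles-from-y IHʸ)) ⟩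
      ∑[ c ∈ Sˣ ] partitionSum κ (x ∷ c) + ∑[ c ∈ Sʸ ] partitionSum κ (y ∷ c)
        ≡⟨ ≡.sym (≡.cong₂ _+_ (∑-map (x ∷_) Sˣ (partitionSum κ)) (∑-map (y ∷_) Sʸ (partitionSum κ))) ⟩
      ∑ (map (x ∷_) Sˣ) (partitionSum κ) + ∑ (map (y ∷_) Sʸ) (partitionSum κ)
        ≈⟨ sym (∑-++ (map (x ∷_) Sˣ) _ (partitionSum κ)) ⟩
      ∑[ c ∈ shuffle (x ∷ a) (y ∷ b) ] partitionSum κ c ∎
      where
      Sˣ = shuffle a (y ∷ b)
      Sʸ = shuffle (x ∷ a) b

  partitionSum-shuffle : ∀ a b → SymbolDisjoint a b → ∀ κ →
    partitionSum κ a * partitionSum κ b ≈ ∑[ c ∈ shuffle a b ] partitionSum κ c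
  partitionSum-shuffle []      b       _ κ = trans (*-identityˡ _) (sym (+-identityʳ _))
  partitionSum-shuffle (x ∷ a) []      _ κ = trans (*-identityʳ _) (sym (+-identityʳ _))
  partitionSum-shuffle (x ∷ a) (y ∷ b) ((x≢y ∷ x#b) ∷ a#yb) κ =
    ShuffleStep.partitionSum-shuffle-∷ κ x a y b x≢y
      (partitionSum-shuffle a (y ∷ b) a#yb ∘ (_, x))
      (partitionSum-shuffle (x ∷ a) b (x#b ∷ All.map All.tail a#yb) ∘ (_, y))

  Wperm≈partitionSum : ∀ α a → Wperm ε α a m ≈ toLP (evalU α a) * partitionSum (0 , (0 , 0)) a
  Wperm≈partitionSum α a = begin
    shiftY (des a) (scaleS (u * q^ (comaj a)) H) m
      ≈⟨ shiftY-cong (des a) (λ k → *-assoc u (q^ (comaj a)) (H k)) m ⟩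
    shiftY (des a) (scaleS u (scaleS (q^ (comaj a)) H)) m
      ≈⟨ shiftY-scaleS (des a) u (scaleS (q^ (comaj a)) H) m ⟩
    u * shiftY (des a) (scaleS (q^ (comaj a)) H) m
      ≡⟨ ≡.cong₂ (λ d c → u * shiftY d (scaleS (q^ c) H) m) des≡ comaj≡ ⟩
    u * closedForm (length a) (desAfter (0 , 0) a) (comajAfter (0 , 0) a) 0
      ≈⟨ *-congˡ {u} (sym (partitionSum-closedForm a (0 , 0) 0 z≤n)) ⟩
    u * partitionSum (0 , (0 , 0)) a ∎
    where
    u = toLP (evalU α a)
    H = invDenom ε (length a)
    des≡ : des a ≡ desAfter (0 , 0) a
    des≡ = ≡.cong length (Des≡DesAfter⁰ a)
    comaj≡ : comaj a ≡ length a ℕ.* 0 ℕ.+ comajAfter (0 , 0) a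
    comaj≡ = ≡.trans (≡.cong (foldr (λ i s → (length a ∸ i) ℕ.+ s) 0) (Des≡DesAfter⁰ a))
                     (≡.cong (ℕ._+ comajAfter (0 , 0) a) (≡.sym (ℕP.*-zeroʳ (length a))))

  Wperm-shuffle : ∀ α β γ a b → SymbolDisjoint a b → evalU γ a ≡ evalU α a → evalU γ b ≡ evalU β b →
    Wperm ε α a m * Wperm ε β b m ≈ ∑[ c ∈ shuffle a b ] Wperm ε γ c m
  Wperm-shuffle α β γ a b a#b γa≡αa γb≡βb = begin
    Wperm ε α a m * Wperm ε β b m
      ≈⟨ *-cong (Wperm≈partitionSum α a) (Wperm≈partitionSum β b) ⟩
    (uα * Φ a) * (uβ * Φ b)
      ≈⟨ interchange uα (Φ a) uβ (Φ b) ⟩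
    (uα * uβ) * (Φ a * Φ b)
      ≈⟨ *-congˡ {uα * uβ} (partitionSum-shuffle a b a#b (0 , (0 , 0))) ⟩
    (uα * uβ) * ∑[ c ∈ shuffle a b ] Φ c
      ≈⟨ *-distribˡ-∑ (uα * uβ) (shuffle a b) Φ ⟩
    ∑[ c ∈ shuffle a b ] ((uα * uβ) * Φ c)
      ≈⟨ ∑-cong-∈ (λ {c} c∈ → *-congʳ {Φ c} (reflexive (label c∈))) ⟩
    ∑[ c ∈ shuffle a b ] (toLP (evalU γ c) * Φ c)
      ≈⟨ ∑-cong (shuffle a b) (λ c → sym (Wperm≈partitionSum γ c)) ⟩
    ∑[ c ∈ shuffle a b ] Wperm ε γ c m ∎
    where
    Φ = partitionSum (0 , (0 , 0))
    uα = toLP (evalU α a)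
    uβ = toLP (evalU β b)
    label : ∀ {c} → c ∈ shuffle a b → uα * uβ ≡ toLP (evalU γ c)
    label c∈ = ≡.sym (≡.trans (≡.cong toLP (≡.trans (All.lookup (evalU-shuffle γ a b) c∈)
                                                  (≡.cong₂ _*U_ γa≡αa γb≡βb)))
                              (toLP-*U (evalU α a) (evalU β b)))

W≡∑Wperm : ∀ ε f α m → W ε f α m ≡ ∑[ a ∈ f ] Wperm ε α a m
W≡∑Wperm ε []      α m = ≡.refl
W≡∑Wperm ε (a ∷ f) α m = ≡.cong (_+_ (Wperm ε α a m)) (W≡∑Wperm ε f α m)

∑-⧢ : ∀ f g (h : CPerm → LP) → ∑ (f ⧢ g) h ≈ ∑[ a ∈ f ] ∑[ b ∈ g ] ∑ (shuffle a b) h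
∑-⧢ f g h = trans (∑-concatMap _ f h) (∑-cong f (λ a → ∑-concatMap (shuffle a) g h))

theorem2p2 : (f : Config) (α : Labelling) (g : Config) (β : Labelling)
    → LabelledConfig f α → LabelledConfig g β → Coherent f α g β
    → (ε : ℤ) → (W ε f α *Y W ε g β) ≈S W ε (f ⧢ g) ((f , α) ∪L (g , β))
theorem2p2 f α g β lf lg coh@(disj , _) ε m = coeff-≡ (begin
  W ε f α m * W ε g β m
    ≡⟨ ≡.cong₂ _*_ (W≡∑Wperm ε f α m) (W≡∑Wperm ε g β m) ⟩
  ∑[ a ∈ f ] Wperm ε α a m * ∑[ b ∈ g ] Wperm ε β b m
    ≈⟨ ∑-*-∑ f g (λ a → Wperm ε α a m) (λ b → Wperm ε β b m) ⟩
  ∑[ a ∈ f ] ∑[ b ∈ g ] (Wperm ε α a m * Wperm ε β b m)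
    ≈⟨ ∑-cong-∈ (λ {a} a∈f → ∑-cong-∈ (λ {b} b∈g → Wperm-shuffle α β γ a b
         (Disjoint⇒SymbolDisjoint f g disj a∈f b∈g)
         (∪L-agreesˡ f α g β lf a∈f) (∪L-agreesʳ f α g β lg coh b∈g))) ⟩
  ∑[ a ∈ f ] ∑[ b ∈ g ] ∑[ c ∈ shuffle a b ] Wperm ε γ c m
    ≈⟨ sym (∑-⧢ f g (λ c → Wperm ε γ c m)) ⟩
  ∑[ c ∈ f ⧢ g ] Wperm ε γ c m
    ≡⟨ ≡.sym (W≡∑Wperm ε (f ⧢ g) γ m) ⟩
  W ε (f ⧢ g) γ m ∎)
  where
  γ = (f , α) ∪L (g , β)
  open PartitionSums ε m using (Wperm-shuffle)
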